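{- Let $k\geq 2$ and $n\geq 3k$ be integers. Then \[ ar(n,\{K_{1,k+1},(k+1)K_2\})\geq\begin{cases} 4, & \text{if } k=2,\\ k^2-k+2, & \text{if } k \text{ is odd},\\ k^2-\frac{3}{2}k+2, & \text{if } k \text{ is even and } k\geq 4. \end{cases} \]
   Context: All graphs are finite and simple. $K_{1,m}$ denotes the star with $m$ edges, and $mK_2$ denotes a matching with $m$ edges. An edge-colored graph is rainbow if all its edges have distinct colors. For a positive integer $n$ and a family of graphs $\mathcal{G}$, the anti-Ramsey number $ar(n,\mathcal{G})$ is the minimum number $r$ such that every edge-coloring of the complete graph $K_n$ using exactly $r$ colors contains a rainbow copy of some graph in $\mathcal{G}$. -}

module Defs where

open import Level using (0ℓ)
open import Data.Nat using (ℕ; zero; suc; _≤_; _<_)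
open import Data.Fin using (Fin)
open import Data.Bool using (Bool)
open import Data.Maybe using (Maybe; just; nothing)
open import Data.Product using (_×_; _,_; Σ; ∃; ∃-syntax)
open import Data.Sum using (_⊎_)
open import Relation.Binary.PropositionalEquality using (_≡_; _≢_)
open import Data.Empty using (⊥)
open import Data.Unit using (⊤)
open import Relation.Nullary using (¬_)

record Graph : Set₁ where
  field
    V   : Set
    Adj : V → V → Set

open Graph public

Star : ℕ → Graph
Star m = record { V = Maybe (Fin m) ; Adj = adj }
  where
  adj : Maybe (Fin m) → Maybe (Fin m) → Set
  adj nothing  nothing  = ⊥
  adj nothing  (just _) = ⊤
  adj (just _) nothing  = ⊤
  adj (just _) (just _) = ⊥

Matching : ℕ → Graph
Matching m = record { V = Fin m × Bool
                    ; Adj = λ { (i , a) (j , b) → (i ≡ j) × (a ≢ b) } }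

-- Edge-colourings of K_n with colours in Fin r: a symmetric map on
-- ordered pairs of distinct vertices (values on the diagonal are irrelevant).
record Colouring (n r : ℕ) : Set where
  field
    col : Fin n → Fin n → Fin r
    sym : ∀ i j → col i j ≡ col j i

open Colouring public

UsesExactly : ∀ {n r} → Colouring n r → Set
UsesExactly {n} {r} c = ∀ (x : Fin r) → ∃[ i ] ∃[ j ] (i ≢ j × col c i j ≡ x)

SameEdge : ∀ {A : Set} → A → A → A → A → Set
SameEdge u v u' v' = (u ≡ u' × v ≡ v') ⊎ (u ≡ v' × v ≡ u')

RainbowCopy : ∀ {n r} → Colouring n r → Graph → Set
RainbowCopy {n} c H =
  Σ (V H → Fin n) λ φ →
    (∀ u v → φ u ≡ φ v → u ≡ v) ×
    (∀ u v u' v' → Adj H u v → Adj H u' v' →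
       col c (φ u) (φ v) ≡ col c (φ u') (φ v') → SameEdge u v u' v')

ForcesRainbow : ℕ → ℕ → ℕ → Set
ForcesRainbow n k r =
  ∀ (c : Colouring n r) → UsesExactly c →
    RainbowCopy c (Star (suc k)) ⊎ RainbowCopy c (Matching (suc k))

-- ar(n, {K_{1,k+1}, (k+1)K_2}) ≥ L  :⇔  every positive r with the property is ≥ L
-- (ar is the minimum positive r with the property).
ArAtLeast : ℕ → ℕ → ℕ → Set
ArAtLeast n k L = ∀ r → 1 ≤ r → ForcesRainbow n k r → L ≤ r

-- An edge-colouring with N colours and no rainbow K_{1,k+1} or (k+1)K₂ shows ar ≥ N + 1, since merging
-- colours keeps it rainbow-free. Take a graph G with Δ(G) ≤ k - 1 and ν(G) ≤ k - 1, give its edges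
-- pairwise distinct colours and all other pairs one further colour: every vertex then sees at most k
-- colours, and a rainbow matching has at most one edge outside G, so ar ≥ |E(G)| + 2. For odd k,
-- G = 2K_k has k(k - 1) edges. For even k, G is the cocktail party graph on k vertices with an apex
-- joined to all but one of them, next to K_{k/2 - 1, k - 1}; it has k² - 3k/2 edges on at most 3k
-- vertices. For k = 2 the three colour classes {01}, {0v : v ≥ 2} and the rest do better.
module Submission where

open import Data.Bool using (Bool; true; false; not; _xor_; if_then_else_)
open import Data.Bool.Properties using (not-¬)
open import Data.Empty using (⊥-elim)
open import Data.Fin as Fin using (Fin; zero; suc; toℕ; fromℕ<; inject≤; punchIn; punchOut)
import Data.Fin.Properties as Finₚ
open import Data.Maybe using (Maybe; just; nothing)
open import Data.Maybe.Properties using (just-injective)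
open import Data.Nat using (ℕ; zero; suc; _+_; _*_; _∸_; _/_; _⊓_; _≤_; _<_; _≤?_; s≤s; s≤s⁻¹)
open import Data.Nat.DivMod using (_%_; m%n<n; m≡m%n+[m/n]*n; m*n/n≡m)
open import Data.Nat.Divisibility using (_∣_; divides)
open import Data.Nat.Properties
open import Data.Nat.Tactic.RingSolver using (solve-∀)
open import Data.Product using (_×_; _,_; Σ; ∃-syntax; proj₁; proj₂; map₁)
open import Data.Product.Function.NonDependent.Propositional using (_×-↔_)
open import Data.Sum as Sum using (_⊎_; inj₁; inj₂; swap)
open import Data.Sum.Function.Propositional using (_⊎-↔_; _⊎-↣_)
import Data.Sum.Properties as Sumₚ
open import Data.Unit using (⊤; tt)
open import Defs hiding (sym)
open import Function using (_∘_; id)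
open import Function.Bundles using (_↔_; _↣_; Inverse; Injection; mk↣)
open import Function.Properties.Injection using (↣-refl; ↣-trans)
open import Function.Properties.Inverse using (↔⇒↣; ↔-refl; ↔-sym; ↔-trans)
open import Level using (0ℓ)
open import Relation.Binary using (Rel; Symmetric; Irreflexive)
open import Relation.Binary.Definitions using (tri<; tri≈; tri>)
open import Relation.Binary.PropositionalEquality
open import Relation.Nullary using (¬_; Dec; yes; no; does; contradiction)
open import Relation.Nullary.Decidable using (_×-dec_; _⊎-dec_; dec-true; dec-false)

does-true⇒ : ∀ {A : Set} (d : Dec A) → does d ≡ true → A
does-true⇒ (yes a) _ = a

does-false⇒ : ∀ {A : Set} (d : Dec A) → not (does d) ≡ true → ¬ A
does-false⇒ (no ¬a) _ = ¬a

↔-injective : ∀ {A B : Set} (ι : A ↔ B) {x y} → Inverse.to ι x ≡ Inverse.to ι y → x ≡ y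
↔-injective ι = Injection.injective (↔⇒↣ ι)

inject≤-↣ : ∀ {m n} → m ≤ n → Fin m ↣ Fin n
inject≤-↣ m≤n = mk↣ (Finₚ.inject≤-injective m≤n m≤n _ _)

×Bool↔ : ∀ {m} → Fin (m * 2) ↔ (Fin m × Bool)
×Bool↔ = ↔-trans Finₚ.*↔× (↔-refl ×-↔ Finₚ.2↔Bool)

m*2≡m+m : ∀ m → m * 2 ≡ m + m
m*2≡m+m m = trans (*-comm m 2) (cong (m +_) (+-identityʳ m))

<?-flip : ∀ {k} {i j : Fin k} → i ≢ j → does (i Fin.<? j) ≡ not (does (j Fin.<? i))
<?-flip {i = i} {j} i≢j with Finₚ.<-cmp i j
... | tri< i<j _ j≮i = trans (dec-true (i Fin.<? j) i<j) (cong not (sym (dec-false (j Fin.<? i) j≮i)))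
... | tri≈ _ i≡j _   = contradiction i≡j i≢j
... | tri> i≮j _ j<i = trans (dec-false (i Fin.<? j) i≮j) (cong not (sym (dec-true (j Fin.<? i) j<i)))

not-xor-xor : ∀ x b → not x xor (x xor b) ≡ not b
not-xor-xor true  b = refl
not-xor-xor false b = refl

is-inj₁ : ∀ {A B : Set} → A ⊎ B → Bool
is-inj₁ (inj₁ _) = true
is-inj₁ (inj₂ _) = false

is-inj₁-swap : ∀ {A B : Set} (x : A ⊎ B) → is-inj₁ (swap x) ≡ not (is-inj₁ x)
is-inj₁-swap (inj₁ _) = refl
is-inj₁-swap (inj₂ _) = refl

count : ∀ {m} → (Fin m → Bool) → ℕ
count {zero}  P = 0
count {suc m} P = (if P zero then suc else id) (count (P ∘ suc))

count-partition : ∀ {m} (P : Fin m → Bool) → count P + count (not ∘ P) ≡ m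
count-partition {zero}  P = refl
count-partition {suc m} P with P zero
... | true  = cong suc (count-partition (P ∘ suc))
... | false = trans (+-suc _ _) (cong suc (count-partition (P ∘ suc)))

count-cong : ∀ {m} {P Q : Fin m → Bool} → (∀ i → P i ≡ Q i) → count P ≡ count Q
count-cong {zero}  P≗Q = refl
count-cong {suc m} {P} {Q} P≗Q rewrite P≗Q zero = cong (if Q zero then suc else id) (count-cong (P≗Q ∘ suc))

select : ∀ {m} (P : Fin m → Bool) → Fin (count P) → Fin m
select {suc m} P j with P zero
... | true with j
...   | zero   = zero
...   | suc j′ = suc (select (P ∘ suc) j′)
select {suc m} P j | false = suc (select (P ∘ suc) j)

select-satisfies : ∀ {m} (P : Fin m → Bool) j → P (select P j) ≡ true
select-satisfies {suc m} P j with P zero in eq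
... | true with j
...   | zero   = eq
...   | suc j′ = select-satisfies (P ∘ suc) j′
select-satisfies {suc m} P j | false = select-satisfies (P ∘ suc) j

select-injective : ∀ {m} (P : Fin m → Bool) {j j′} → select P j ≡ select P j′ → j ≡ j′
select-injective {suc m} P {j} {j′} eq with P zero
... | true with j | j′
...   | zero  | zero  = refl
...   | suc a | suc b = cong suc (select-injective (P ∘ suc) (Finₚ.suc-injective eq))
select-injective {suc m} P eq | false = select-injective (P ∘ suc) (Finₚ.suc-injective eq)

-- ν(R) < k, where a matching of m edges is an injection φ : Fin m × Bool → V
-- whose edge i joins φ (i , false) and φ (i , true)
MatchingNumber< : ∀ {V : Set} → Rel V 0ℓ → ℕ → Set
MatchingNumber< {V} R k = ∀ m (φ : Fin m × Bool → V) → (∀ a b → φ a ≡ φ b → a ≡ b) →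
  (∀ i → R (φ (i , false)) (φ (i , true))) → m < k

-- Δ(R) ≤ k: the neighbours of each vertex are told apart by k slots
MaxDegree≤ : ∀ {V : Set} → Rel V 0ℓ → ℕ → Set
MaxDegree≤ {V} R k = Σ (∀ {v u} → R v u → Fin k) λ slot →
  ∀ {v u u′} (r : R v u) (r′ : R v u′) → slot r ≡ slot r′ → u ≡ u′

MatchingNumber<-mono : ∀ {V : Set} {R S : Rel V 0ℓ} {k} → (∀ u v → R u v → S u v) →
  MatchingNumber< S k → MatchingNumber< R k
MatchingNumber<-mono R⊆S ν< m φ φ-inj edges = ν< m φ φ-inj (λ i → R⊆S _ _ (edges i))

MatchingNumber<-≤ : ∀ {V : Set} {R : Rel V 0ℓ} {k k′} → k ≤ k′ → MatchingNumber< R k → MatchingNumber< R k′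
MatchingNumber<-≤ k≤k′ ν< m φ φ-inj edges = <-≤-trans (ν< m φ φ-inj edges) k≤k′

select-matching-injective : ∀ {V : Set} {m} (φ : Fin m × Bool → V) → (∀ a b → φ a ≡ φ b → a ≡ b) →
  (P : Fin m → Bool) → ∀ a b → φ (map₁ (select P) a) ≡ φ (map₁ (select P) b) → a ≡ b
select-matching-injective φ φ-inj P a b eq =
  cong₂ _,_ (select-injective P (cong proj₁ same)) (cong proj₂ same)
  where
  same : (select P (proj₁ a) , proj₂ a) ≡ (select P (proj₁ b) , proj₂ b)
  same = φ-inj _ _ eq

MatchingNumber<-vertices : ∀ {V : Set} {R : Rel V 0ℓ} h → V ↣ Fin (suc (h * 2)) →
  MatchingNumber< R (suc h)
MatchingNumber<-vertices h ι m φ φ-inj _ =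
  s≤s (m*2≤suc[h*2]⇒m≤h (Finₚ.injective⇒≤ {f = to ∘ φ ∘ endpoint}
    (↔-injective ×Bool↔ ∘ φ-inj _ _ ∘ injective)))
  where
  open Injection ι using (to; injective)
  endpoint : Fin (m * 2) → Fin m × Bool
  endpoint = Inverse.to ×Bool↔
  m*2≤suc[h*2]⇒m≤h : ∀ {m h} → m * 2 ≤ suc (h * 2) → m ≤ h
  m*2≤suc[h*2]⇒m≤h {m} {h} le = s≤s⁻¹ (*-cancelʳ-< 2 m (suc h) (s≤s le))

-- each edge of a matching contains its own vertex of a vertex cover
MatchingNumber<-cover : ∀ {V : Set} {R : Rel V 0ℓ} {a} (cover : Fin a → V) →
  (∀ {x y} → R x y → Σ (Fin a) λ c → cover c ≡ x ⊎ cover c ≡ y) → MatchingNumber< R (suc a)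
MatchingNumber<-cover cover covers m φ φ-inj edges =
  s≤s (Finₚ.injective⇒≤ {f = proj₁ ∘ covers ∘ edges} λ {i} {j} eq →
    cong proj₁ (φ-inj _ _ (trans (proj₂ (covered i)) (trans (cong cover eq) (sym (proj₂ (covered j)))))))
  where
  covered : ∀ i → Σ Bool λ b → φ (i , b) ≡ cover (proj₁ (covers (edges i)))
  covered i with covers (edges i)
  ... | _ , inj₁ eq = false , sym eq
  ... | _ , inj₂ eq = true , sym eq

record EdgeList {V : Set} (R : Rel V 0ℓ) (M : ℕ) : Set₁ where
  field
    Edge     : Set
    index    : Fin M ↔ Edge
    src tgt  : Edge → V
    adjacent : ∀ e → R (src e) (tgt e)
    distinct : ∀ e e′ → SameEdge (src e) (tgt e) (src e′) (tgt e′) → e ≡ e′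

SameEdge-map : ∀ {A B : Set} (f : A → B) → (∀ {x y} → f x ≡ f y → x ≡ y) →
  ∀ {u v u′ v′} → SameEdge (f u) (f v) (f u′) (f v′) → SameEdge u v u′ v′
SameEdge-map f f-inj (inj₁ (eq₁ , eq₂)) = inj₁ (f-inj eq₁ , f-inj eq₂)
SameEdge-map f f-inj (inj₂ (eq₁ , eq₂)) = inj₂ (f-inj eq₁ , f-inj eq₂)

SameEdge-sym : ∀ {A : Set} {u v u′ v′ : A} → SameEdge u v u′ v′ → SameEdge v u u′ v′
SameEdge-sym (inj₁ (eq₁ , eq₂)) = inj₂ (eq₂ , eq₁)
SameEdge-sym (inj₂ (eq₁ , eq₂)) = inj₁ (eq₂ , eq₁)

SameEdge-trans : ∀ {A : Set} {u v u′ v′ u″ v″ : A} →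
  SameEdge u v u′ v′ → SameEdge u v u″ v″ → SameEdge u′ v′ u″ v″
SameEdge-trans (inj₁ (refl , refl)) e = e
SameEdge-trans (inj₂ (refl , refl)) e = SameEdge-sym e

private variable
  V₁ V₂ : Set
  R₁ : Rel V₁ 0ℓ
  R₂ : Rel V₂ 0ℓ

data _⊕_ {V₁ V₂ : Set} (R₁ : Rel V₁ 0ℓ) (R₂ : Rel V₂ 0ℓ) : Rel (V₁ ⊎ V₂) 0ℓ where
  left  : ∀ {a b} → R₁ a b → (R₁ ⊕ R₂) (inj₁ a) (inj₁ b)
  right : ∀ {a b} → R₂ a b → (R₁ ⊕ R₂) (inj₂ a) (inj₂ b)

⊕-sym : Symmetric R₁ → Symmetric R₂ → Symmetric (R₁ ⊕ R₂)
⊕-sym sym₁ sym₂ (left r)  = left (sym₁ r)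
⊕-sym sym₁ sym₂ (right r) = right (sym₂ r)

⊕-irrefl : Irreflexive _≡_ R₁ → Irreflexive _≡_ R₂ → Irreflexive _≡_ (R₁ ⊕ R₂)
⊕-irrefl irr₁ irr₂ refl (left r)  = irr₁ refl r
⊕-irrefl irr₁ irr₂ refl (right r) = irr₂ refl r

⊕-swap : ∀ {x y} → (R₁ ⊕ R₂) x y → (R₂ ⊕ R₁) (swap x) (swap y)
⊕-swap (left r)  = right r
⊕-swap (right r) = left r

⊕-maxDegree : ∀ {k} → MaxDegree≤ R₁ k → MaxDegree≤ R₂ k → MaxDegree≤ (R₁ ⊕ R₂) k
⊕-maxDegree {R₁ = R₁} {R₂ = R₂} {k = k} (slot₁ , slot₁-injective) (slot₂ , slot₂-injective) =
  slot , slot-injective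
  where
  slot : ∀ {v u} → (R₁ ⊕ R₂) v u → Fin k
  slot (left r)  = slot₁ r
  slot (right r) = slot₂ r
  slot-injective : ∀ {v u u′} (r : (R₁ ⊕ R₂) v u) r′ → slot r ≡ slot r′ → u ≡ u′
  slot-injective (left r)  (left r′)  eq = cong inj₁ (slot₁-injective r r′ eq)
  slot-injective (right r) (right r′) eq = cong inj₂ (slot₂-injective r r′ eq)

module _ {R₁ : Rel V₁ 0ℓ} {R₂ : Rel V₂ 0ℓ} where

  private
    from-inj₁ : (x : V₁ ⊎ V₂) → is-inj₁ x ≡ true → V₁
    from-inj₁ (inj₁ a) _ = a

    from-inj₁-injective : ∀ {x y} p q → from-inj₁ x p ≡ from-inj₁ y q → x ≡ y
    from-inj₁-injective {inj₁ _} {inj₁ _} _ _ = cong inj₁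

    ⊕-same-side : ∀ {x y} → (R₁ ⊕ R₂) x y → is-inj₁ x ≡ true → is-inj₁ y ≡ true
    ⊕-same-side (left _) = id

    left⁻¹ : ∀ {x y} (r : (R₁ ⊕ R₂) x y) p → R₁ (from-inj₁ x p) (from-inj₁ y (⊕-same-side r p))
    left⁻¹ (left r) _ = r

  -- the edges of a matching of R₁ ⊕ R₂ lying in V₁ form a matching of R₁
  ⊕-left-edges : ∀ {k} → MatchingNumber< R₁ (suc k) → ∀ m (φ : Fin m × Bool → V₁ ⊎ V₂) →
    (∀ a b → φ a ≡ φ b → a ≡ b) → (∀ i → (R₁ ⊕ R₂) (φ (i , false)) (φ (i , true))) →
    count (is-inj₁ ∘ φ ∘ (_, false)) ≤ k
  ⊕-left-edges ν₁< m φ φ-inj edges =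
    s≤s⁻¹ (ν₁< _ ψ ψ-injective λ j → left⁻¹ (edges (select P j)) (in-V₁ j false))
    where
    P : Fin m → Bool
    P = is-inj₁ ∘ φ ∘ (_, false)
    in-V₁ : ∀ j x → is-inj₁ (φ (select P j , x)) ≡ true
    in-V₁ j false = select-satisfies P j
    in-V₁ j true  = ⊕-same-side (edges (select P j)) (in-V₁ j false)
    ψ : Fin (count P) × Bool → V₁
    ψ (j , x) = from-inj₁ (φ (select P j , x)) (in-V₁ j x)
    ψ-injective : ∀ a b → ψ a ≡ ψ b → a ≡ b
    ψ-injective a b eq = select-matching-injective φ φ-inj P a b (from-inj₁-injective _ _ eq)

⊕-matchingNumber : ∀ {k₁ k₂} →
  MatchingNumber< R₁ (suc k₁) → MatchingNumber< R₂ (suc k₂) → MatchingNumber< (R₁ ⊕ R₂) (suc (k₁ + k₂))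
⊕-matchingNumber {R₁ = R₁} {R₂ = R₂} {k₁ = k₁} {k₂ = k₂} ν₁< ν₂< m φ φ-inj edges = s≤s (begin
  m                                ≡⟨ sym (count-partition P) ⟩
  count P + count (not ∘ P)        ≡⟨ cong (count P +_) (count-cong (sym ∘ is-inj₁-swap ∘ φ ∘ (_, false))) ⟩
  count P + count (is-inj₁ ∘ swap ∘ φ ∘ (_, false))
                                   ≤⟨ +-mono-≤ (⊕-left-edges ν₁< m φ φ-inj edges)
                                        (⊕-left-edges {R₁ = R₂} {R₂ = R₁} ν₂< m (swap ∘ φ) swapped-injective
                                          (⊕-swap ∘ edges)) ⟩
  k₁ + k₂                          ∎)
  where
  open ≤-Reasoning
  P : Fin m → Bool
  P = is-inj₁ ∘ φ ∘ (_, false)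
  swapped-injective : ∀ a b → swap (φ a) ≡ swap (φ b) → a ≡ b
  swapped-injective a b eq = φ-inj a b (E.begin
    φ a               E.≡⟨ sym (Sumₚ.swap-involutive (φ a)) ⟩
    swap (swap (φ a)) E.≡⟨ cong swap eq ⟩
    swap (swap (φ b)) E.≡⟨ Sumₚ.swap-involutive (φ b) ⟩
    φ b               E.∎)
    where module E = ≡-Reasoning

⊕-edgeList : ∀ {V₁ V₂ : Set} {R₁ : Rel V₁ 0ℓ} {R₂ : Rel V₂ 0ℓ} {M₁ M₂} →
  EdgeList R₁ M₁ → EdgeList R₂ M₂ → EdgeList (R₁ ⊕ R₂) (M₁ + M₂)
⊕-edgeList {V₁ = V₁} {V₂ = V₂} G₁ G₂ = record
  { Edge     = G₁.Edge ⊎ G₂.Edge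
  ; index    = ↔-trans Finₚ.+↔⊎ (G₁.index ⊎-↔ G₂.index)
  ; src      = src
  ; tgt      = tgt
  ; adjacent = λ { (inj₁ e) → left (G₁.adjacent e) ; (inj₂ e) → right (G₂.adjacent e) }
  ; distinct = distinct
  }
  where
  module G₁ = EdgeList G₁
  module G₂ = EdgeList G₂
  src tgt : G₁.Edge ⊎ G₂.Edge → V₁ ⊎ V₂
  src = Sum.map G₁.src G₂.src
  tgt = Sum.map G₁.tgt G₂.tgt
  distinct : ∀ e e′ → SameEdge (src e) (tgt e) (src e′) (tgt e′) → e ≡ e′
  distinct (inj₁ e) (inj₁ e′) = cong inj₁ ∘ G₁.distinct e e′ ∘ SameEdge-map inj₁ Sumₚ.inj₁-injective
  distinct (inj₂ e) (inj₂ e′) = cong inj₂ ∘ G₂.distinct e e′ ∘ SameEdge-map inj₂ Sumₚ.inj₂-injective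
  distinct (inj₁ _) (inj₂ _) (inj₁ (() , _))
  distinct (inj₁ _) (inj₂ _) (inj₂ (() , _))
  distinct (inj₂ _) (inj₁ _) (inj₁ (() , _))
  distinct (inj₂ _) (inj₁ _) (inj₂ (() , _))

Complete : ∀ {k} → Rel (Fin k) 0ℓ
Complete i j = i ≢ j

Complete-sym : ∀ {k} → Symmetric (Complete {k})
Complete-sym i≢j = i≢j ∘ sym

Complete-irrefl : ∀ {k} → Irreflexive _≡_ (Complete {k})
Complete-irrefl i≡j i≢j = i≢j i≡j

Complete-maxDegree : ∀ {k} → MaxDegree≤ (Complete {suc k}) k
Complete-maxDegree = punchOut , λ i≢j i≢j′ → Finₚ.punchOut-injective i≢j i≢j′

data Bipartite {a b : ℕ} : Rel (Fin a ⊎ Fin b) 0ℓ where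
  lr : ∀ {i j} → Bipartite (inj₁ i) (inj₂ j)
  rl : ∀ {i j} → Bipartite (inj₂ j) (inj₁ i)

Bipartite-sym : ∀ {a b} → Symmetric (Bipartite {a} {b})
Bipartite-sym lr = rl
Bipartite-sym rl = lr

Bipartite-irrefl : ∀ {a b} → Irreflexive _≡_ (Bipartite {a} {b})
Bipartite-irrefl refl ()

Bipartite-maxDegree : ∀ {a b} → a ≤ b → MaxDegree≤ (Bipartite {a} {b}) b
Bipartite-maxDegree {a} {b} a≤b = slot , slot-injective
  where
  slot : ∀ {v u} → Bipartite v u → Fin b
  slot (lr {j = j}) = j
  slot (rl {i = i}) = inject≤ i a≤b
  slot-injective : ∀ {v u u′} (r : Bipartite v u) (r′ : Bipartite v u′) → slot r ≡ slot r′ → u ≡ u′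
  slot-injective lr lr eq = cong inj₂ eq
  slot-injective rl rl eq = cong inj₁ (Finₚ.inject≤-injective a≤b a≤b _ _ eq)

Bipartite-matchingNumber : ∀ {a b} → MatchingNumber< (Bipartite {a} {b}) (suc a)
Bipartite-matchingNumber {a} {b} = MatchingNumber<-cover {R = Bipartite {a} {b}} inj₁
  λ { (lr {i}) → i , inj₁ refl ; (rl {i}) → i , inj₂ refl }

Bipartite-edges : ∀ {a b} → EdgeList (Bipartite {a} {b}) (a * b)
Bipartite-edges {a} {b} = record
  { Edge     = Fin a × Fin b
  ; index    = Finₚ.*↔×
  ; src      = inj₁ ∘ proj₁
  ; tgt      = inj₂ ∘ proj₂
  ; adjacent = λ _ → lr
  ; distinct = distinct
  }
  where
  distinct : ∀ (e e′ : Fin a × Fin b) →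
    SameEdge (inj₁ (proj₁ e)) (inj₂ (proj₂ e)) (inj₁ (proj₁ e′)) (inj₂ (proj₂ e′)) → e ≡ e′
  distinct _ _ (inj₁ (refl , refl)) = refl

-- at most k colours appear on the edges at v
ColourDegree≤ : ∀ {n r} → Colouring n r → Fin n → ℕ → Set
ColourDegree≤ {n} c v k = Σ (Fin n → Fin k) λ class →
  ∀ u u′ → u ≢ v → u′ ≢ v → class u ≡ class u′ → col c v u ≡ col c v u′

no-rainbow-star : ∀ {n r} (c : Colouring n r) k → (∀ v → ColourDegree≤ c v k) →
  ¬ RainbowCopy c (Star (suc k))
no-rainbow-star c k deg (φ , φ-inj , rainbow)
  with class , class-ok ← deg (φ nothing)
  with i , j , i<j , same-class ← Finₚ.pigeonhole (n<1+n k) (λ i → class (φ (just i)))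
  with rainbow nothing (just i) nothing (just j) tt tt
         (class-ok _ _ (leaf≢centre i) (leaf≢centre j) same-class)
  where
  leaf≢centre : ∀ i → φ (just i) ≢ φ nothing
  leaf≢centre i eq with () ← φ-inj _ _ eq
... | inj₁ (_ , just-i≡just-j) = Finₚ.<⇒≢ i<j (just-injective just-i≡just-j)
... | inj₂ (() , _)

-- a rainbow (k+1)K₂ has at most one edge of colour z
no-rainbow-matching : ∀ {n r} (c : Colouring n r) (z : Fin r) k →
  MatchingNumber< (λ u v → col c u v ≢ z) k → ¬ RainbowCopy c (Matching (suc k))
no-rainbow-matching {r = r} c z k ν< (φ , φ-inj , rainbow) = <-irrefl refl (begin
    suc k                           ≡⟨ sym (count-partition coloured-z) ⟩
    count coloured-z + count others ≤⟨ +-monoˡ-≤ (count others) at-most-one ⟩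
    suc (count others)              ≤⟨ others< ⟩
    k                               ∎)
  where
  open ≤-Reasoning
  colour : Fin (suc k) → Fin r
  colour i = col c (φ (i , false)) (φ (i , true))
  coloured-z others : Fin (suc k) → Bool
  coloured-z i = does (colour i Fin.≟ z)
  others = not ∘ coloured-z
  colour-injective : ∀ {i j} → colour i ≡ colour j → i ≡ j
  colour-injective {i} {j} eq with rainbow (i , false) (i , true) (j , false) (j , true)
                                      (refl , λ ()) (refl , λ ()) eq
  ... | inj₁ (refl , _) = refl
  ... | inj₂ (() , _)
  at-most-one : count coloured-z ≤ 1
  at-most-one = Finₚ.injective⇒≤ {f = λ _ → zero} λ {j} {j′} _ → select-injective coloured-z
    (colour-injective (trans (does-true⇒ (_ Fin.≟ z) (select-satisfies coloured-z j))
                        (sym (does-true⇒ (_ Fin.≟ z) (select-satisfies coloured-z j′)))))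
  others< : count others < k
  others< = ν< (count others) (φ ∘ map₁ (select others))
    (select-matching-injective φ φ-inj others)
    (λ j → does-false⇒ (_ Fin.≟ z) (select-satisfies others j))

RainbowFree : ∀ {n r} → Colouring n r → ℕ → Set
RainbowFree c k = ¬ RainbowCopy c (Star (suc k)) × ¬ RainbowCopy c (Matching (suc k))

recolour : ∀ {n r s} → Colouring n r → (Fin r → Fin s) → Colouring n s
recolour c g = record { col = λ u v → g (col c u v) ; sym = λ u v → cong g (Colouring.sym c u v) }

recolour-rainbow : ∀ {n r s} (c : Colouring n r) (g : Fin r → Fin s) H →
  RainbowCopy (recolour c g) H → RainbowCopy c H
recolour-rainbow c g H (φ , φ-inj , rainbow) =
  φ , φ-inj , λ u v u′ v′ a a′ eq → rainbow u v u′ v′ a a′ (cong g eq)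

truncate : ∀ {N} r → Fin N → Fin (suc r)
truncate r x = fromℕ< (s≤s (m⊓n≤n (toℕ x) r))

truncate-inject≤ : ∀ {N} r (y : Fin (suc r)) (le : suc r ≤ N) → truncate r (inject≤ y le) ≡ y
truncate-inject≤ r y le = Finₚ.toℕ-injective (begin
  toℕ (truncate r (inject≤ y le)) ≡⟨ Finₚ.toℕ-fromℕ< _ ⟩
  toℕ (inject≤ y le) ⊓ r          ≡⟨ cong (_⊓ r) (Finₚ.toℕ-inject≤ y le) ⟩
  toℕ y ⊓ r                       ≡⟨ m≤n⇒m⊓n≡m (s≤s⁻¹ (Finₚ.toℕ<n y)) ⟩
  toℕ y                           ∎)
  where open ≡-Reasoning

rainbow-free⇒ArAtLeast : ∀ {n k N} (c : Colouring n N) → UsesExactly c → RainbowFree c k →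
  ArAtLeast n k (suc N)
rainbow-free⇒ArAtLeast {n} {N = N} c surjective (no-star , no-matching) (suc r) _ forces
  with suc N ≤? suc r
... | yes N<r = N<r
... | no  N≮r with forces merged merged-surjective
  where
  r<N : suc r ≤ N
  r<N = s≤s⁻¹ (≰⇒> N≮r)
  merged : Colouring n (suc r)
  merged = recolour c (truncate r)
  merged-surjective : UsesExactly merged
  merged-surjective y with i , j , i≢j , eq ← surjective (inject≤ y r<N) =
    i , j , i≢j , trans (cong (truncate r) eq) (truncate-inject≤ r y r<N)
... | inj₁ star     = ⊥-elim (no-star (recolour-rainbow c (truncate r) _ star))
... | inj₂ matching = ⊥-elim (no-matching (recolour-rainbow c (truncate r) _ matching))

module ImageGraph {V : Set} {n} (ι : V ↣ Fin n) (R : Rel V 0ℓ) where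
  open Injection ι using (to; injective)

  record Image (u v : Fin n) : Set where
    constructor image
    field
      source target : V
      to-source     : to source ≡ u
      to-target     : to target ≡ v
      related       : R source target

  ¬Image : ∀ {a b} → ¬ R a b → ¬ Image (to a) (to b)
  ¬Image ¬r (image _ _ eq₁ eq₂ r) with refl ← injective eq₁ | refl ← injective eq₂ = ¬r r

  Image-maxDegree : ∀ {k} → MaxDegree≤ R k → MaxDegree≤ Image k
  Image-maxDegree {k} (slot , slot-injective) = slot ∘ Image.related , Image-slot-injective
    where
    Image-slot-injective : ∀ {v u u′} (r : Image v u) (r′ : Image v u′) →
      slot (Image.related r) ≡ slot (Image.related r′) → u ≡ u′
    Image-slot-injective (image a b ιa refl r) (image a′ b′ ιa′ refl r′) eq
      with refl ← injective (trans ιa (sym ιa′)) = cong to (slot-injective r r′ eq)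

  Image-matchingNumber : ∀ {k} → MatchingNumber< R k → MatchingNumber< Image k
  Image-matchingNumber ν< m φ φ-inj edges = ν< m ψ ψ-injective (Image.related ∘ edges)
    where
    ψ : Fin m × Bool → V
    ψ (i , false) = Image.source (edges i)
    ψ (i , true)  = Image.target (edges i)
    to-ψ : ∀ e → to (ψ e) ≡ φ e
    to-ψ (i , false) = Image.to-source (edges i)
    to-ψ (i , true)  = Image.to-target (edges i)
    ψ-injective : ∀ a b → ψ a ≡ ψ b → a ≡ b
    ψ-injective a b eq = φ-inj a b (trans (sym (to-ψ a)) (trans (cong to eq) (to-ψ b)))

module EdgeColouring {V : Set} {R : Rel V 0ℓ} {n M} (ι : V ↣ Fin n) (G : EdgeList R M) where
  open Injection ι using (to; injective)
  open EdgeList G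
  open ImageGraph ι R

  edge : Fin M → Edge
  edge = Inverse.to index

  Joins : Fin n → Fin n → Fin M → Set
  Joins u v x = SameEdge u v (to (src (edge x))) (to (tgt (edge x)))

  joins? : ∀ u v x → Dec (Joins u v x)
  joins? u v x = ((u Fin.≟ to (src (edge x))) ×-dec (v Fin.≟ to (tgt (edge x))))
           ⊎-dec ((u Fin.≟ to (tgt (edge x))) ×-dec (v Fin.≟ to (src (edge x))))

  joins-unique : ∀ {u v x y} → Joins u v x → Joins u v y → x ≡ y
  joins-unique joins joins′ =
    ↔-injective index (distinct _ _ (SameEdge-map to injective (SameEdge-trans joins joins′)))

  colour : Fin n → Fin n → Fin (suc M)
  colour u v with Finₚ.any? (joins? u v)
  ... | yes (x , _) = suc x
  ... | no  _       = zero

  colour-edge : ∀ {u v x} → Joins u v x → colour u v ≡ suc x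
  colour-edge {u} {v} joins with Finₚ.any? (joins? u v)
  ... | yes (y , joins′) = cong suc (joins-unique joins′ joins)
  ... | no  ¬joins       = contradiction (_ , joins) ¬joins

  colour-non-edge : ∀ {u v} → (∀ x → ¬ Joins u v x) → colour u v ≡ zero
  colour-non-edge {u} {v} ¬joins with Finₚ.any? (joins? u v)
  ... | yes (x , joins) = contradiction joins (¬joins x)
  ... | no  _           = refl

  colour-sym : ∀ u v → colour u v ≡ colour v u
  colour-sym u v with Finₚ.any? (joins? u v)
  ... | yes (x , joins) = sym (colour-edge (SameEdge-sym joins))
  ... | no  ¬joins      = sym (colour-non-edge (λ x joins → ¬joins (x , SameEdge-sym joins)))

  colouring : Colouring n (suc M)
  colouring = record { col = colour ; sym = colour-sym }

  module _ (R-sym : Symmetric R) (R-irrefl : Irreflexive _≡_ R)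
    {a₀ b₀} (a₀≢b₀ : a₀ ≢ b₀) (a₀≁b₀ : ¬ R a₀ b₀) where

    joins⇒Image : ∀ {u v x} → Joins u v x → Image u v
    joins⇒Image (inj₁ (refl , refl)) = image _ _ refl refl (adjacent _)
    joins⇒Image (inj₂ (refl , refl)) = image _ _ refl refl (R-sym (adjacent _))

    colour-surjective : UsesExactly colouring
    colour-surjective zero    = to a₀ , to b₀ , a₀≢b₀ ∘ injective ,
                                colour-non-edge (λ x → ¬Image a₀≁b₀ ∘ joins⇒Image)
    colour-surjective (suc x) = to (src (edge x)) , to (tgt (edge x)) , src≢tgt ,
                                colour-edge (inj₁ (refl , refl))
      where
      src≢tgt : to (src (edge x)) ≢ to (tgt (edge x))
      src≢tgt eq = R-irrefl (injective eq) (adjacent (edge x))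

    colour-degree : ∀ {k} → MaxDegree≤ Image k → ∀ v → ColourDegree≤ colouring v (suc k)
    colour-degree {k} Δ v = class , class-ok
      where
      slot : ∀ {u} → Image v u → Fin k
      slot = proj₁ Δ
      class : Fin n → Fin (suc k)
      class u with Finₚ.any? (joins? v u)
      ... | yes (_ , joins) = suc (slot (joins⇒Image joins))
      ... | no  _           = zero
      class-ok : ∀ u u′ → u ≢ v → u′ ≢ v → class u ≡ class u′ → colour v u ≡ colour v u′
      class-ok u u′ _ _ eq with Finₚ.any? (joins? v u) | Finₚ.any? (joins? v u′)
      ... | yes (x , joins) | yes (x′ , joins′)
            with refl ← proj₂ Δ _ _ (Finₚ.suc-injective eq) = cong suc (joins-unique joins joins′)
      ... | no _ | no _ = refl

    colour-matching : ∀ {k} → MatchingNumber< Image k → MatchingNumber< (λ u v → colour u v ≢ zero) k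
    colour-matching = MatchingNumber<-mono coloured⇒Image
      where
      coloured⇒Image : ∀ u v → colour u v ≢ zero → Image u v
      coloured⇒Image u v ≢zero with Finₚ.any? (joins? u v)
      ... | yes (_ , joins) = joins⇒Image joins
      ... | no  _           = contradiction refl ≢zero

    rainbow-free : ∀ {k} → MaxDegree≤ R k → MatchingNumber< R (suc k) → RainbowFree colouring (suc k)
    rainbow-free Δ ν< =
      no-rainbow-star colouring _ (colour-degree (Image-maxDegree Δ)) ,
      no-rainbow-matching colouring zero _ (colour-matching (Image-matchingNumber ν<))

ArAtLeast-graph : ∀ {V : Set} {R : Rel V 0ℓ} {n k M} → V ↣ Fin n →
  Symmetric R → Irreflexive _≡_ R → EdgeList R M → ∀ {a₀ b₀} → a₀ ≢ b₀ → ¬ R a₀ b₀ →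
  MaxDegree≤ R k → MatchingNumber< R (suc k) → ArAtLeast n (suc k) (suc (suc M))
ArAtLeast-graph ι R-sym R-irrefl G a₀≢b₀ a₀≁b₀ Δ ν< = rainbow-free⇒ArAtLeast colouring
  (colour-surjective R-sym R-irrefl a₀≢b₀ a₀≁b₀) (rainbow-free R-sym R-irrefl a₀≢b₀ a₀≁b₀ Δ ν<)
  where open EdgeColouring ι G

-- Odd k: two disjoint cliques

module TwoCliques (k′ : ℕ) where
  k : ℕ
  k = suc k′

  TwoCliques : Rel (Fin k ⊎ Fin k) 0ℓ
  TwoCliques = Complete ⊕ Complete

  TwoCliques-sym : Symmetric TwoCliques
  TwoCliques-sym = ⊕-sym Complete-sym Complete-sym

  TwoCliques-irrefl : Irreflexive _≡_ TwoCliques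
  TwoCliques-irrefl = ⊕-irrefl Complete-irrefl Complete-irrefl

  place : Bool → Fin k → Fin k ⊎ Fin k
  place true  = inj₁
  place false = inj₂

  place-injective : ∀ {b b′ i j} → place b i ≡ place b′ j → b ≡ b′ × i ≡ j
  place-injective {true}  {true}  refl = refl , refl
  place-injective {false} {false} refl = refl , refl

  place-adjacent : ∀ b {i j} → i ≢ j → TwoCliques (place b i) (place b j)
  place-adjacent true  i≢j = left i≢j
  place-adjacent false i≢j = right i≢j

  -- The ordered pair (p , punchIn p q) of distinct vertices names the edge {p , punchIn p q}
  -- of the first clique if punchIn p q < p, and of the second clique otherwise.
  copy : Fin k × Fin k′ → Bool
  copy (p , q) = does (punchIn p q Fin.<? p)

  src tgt : Fin k × Fin k′ → Fin k ⊎ Fin k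
  src e@(p , q) = place (copy e) p
  tgt e@(p , q) = place (copy e) (punchIn p q)

  p≢punchIn : ∀ (e : Fin k × Fin k′) → proj₁ e ≢ punchIn (proj₁ e) (proj₂ e)
  p≢punchIn (p , q) = Finₚ.punchInᵢ≢i p q ∘ sym

  edges : EdgeList TwoCliques (k * k′)
  edges = record
    { Edge     = Fin k × Fin k′
    ; index    = Finₚ.*↔×
    ; src      = src
    ; tgt      = tgt
    ; adjacent = λ e → place-adjacent (copy e) (p≢punchIn e)
    ; distinct = distinct
    }
    where
    distinct : ∀ e e′ → SameEdge (src e) (tgt e) (src e′) (tgt e′) → e ≡ e′
    distinct (p , q) (p′ , q′) (inj₁ (eq₁ , eq₂))
      with _ , refl ← place-injective eq₁
      with _ , c≡c′ ← place-injective eq₂ = cong (p ,_) (Finₚ.punchIn-injective p q q′ c≡c′)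
    distinct e@(p , q) e′@(p′ , q′) (inj₂ (eq₁ , eq₂))
      with same-copy , p≡c′ ← place-injective eq₁
      with _ , c≡p′ ← place-injective eq₂ = contradiction (<?-flip (p≢punchIn e ∘ sym))
        (not-¬ (trans same-copy (cong₂ (λ x y → does (x Fin.<? y)) (sym p≡c′) (sym c≡p′))))

  maxDegree : MaxDegree≤ TwoCliques k′
  maxDegree = ⊕-maxDegree Complete-maxDegree Complete-maxDegree

  matchingNumber : ∀ h → k′ ≡ h * 2 → MatchingNumber< TwoCliques (suc k′)
  matchingNumber h refl = MatchingNumber<-≤ {R = TwoCliques} (≤-reflexive (cong suc (sym (m*2≡m+m h))))
    (⊕-matchingNumber (MatchingNumber<-vertices {R = Complete {k}} h ↣-refl)
                      (MatchingNumber<-vertices {R = Complete {k}} h ↣-refl))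

ArAtLeast-odd : ∀ {n} h → let k = suc (h * 2) in k + k ≤ n → ArAtLeast n k (k * k ∸ k + 2)
ArAtLeast-odd {n} h k+k≤n = subst (ArAtLeast n k) (sym edge-count)
  (ArAtLeast-graph (↣-trans (↔⇒↣ (↔-sym Finₚ.+↔⊎)) (inject≤-↣ k+k≤n))
    TwoCliques-sym TwoCliques-irrefl edges
    {inj₁ zero} {inj₂ zero} (λ ()) (λ ()) maxDegree (matchingNumber h refl))
  where
  open TwoCliques (h * 2)
  edge-count : k * k ∸ k + 2 ≡ suc (suc (k * (h * 2)))
  edge-count = begin
    k * k ∸ k + 2             ≡⟨ cong (λ x → x ∸ k + 2) (*-suc k (h * 2)) ⟩
    k + k * (h * 2) ∸ k + 2   ≡⟨ cong (_+ 2) (m+n∸m≡n k _) ⟩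
    k * (h * 2) + 2           ≡⟨ +-comm _ 2 ⟩
    suc (suc (k * (h * 2)))   ∎
    where open ≡-Reasoning

-- Even k: a cocktail party graph with an apex

-- The cocktail party graph on the pairs {(i , false), (i , true)}, i < h + 1, and an apex joined to all
-- its vertices but (zero , false): 2h + 3 vertices, Δ = 2h + 1 and 2(h + 1)h + 2h + 1 edges.
module CocktailParty (h : ℕ) where
  H : ℕ
  H = suc h

  Vertex : Set
  Vertex = Maybe (Fin H × Bool)

  pattern apex = nothing
  pattern pair i b = just (i , b)

  data Party : Rel Vertex 0ℓ where
    pair-pair : ∀ {i j b c} → i ≢ j → Party (pair i b) (pair j c)
    apex-pair : ∀ {i b} → (i , b) ≢ (zero , false) → Party apex (pair i b)
    pair-apex : ∀ {i b} → (i , b) ≢ (zero , false) → Party (pair i b) apex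

  Party-sym : Symmetric Party
  Party-sym (pair-pair i≢j) = pair-pair (i≢j ∘ sym)
  Party-sym (apex-pair ne)  = pair-apex ne
  Party-sym (pair-apex ne)  = apex-pair ne

  Party-irrefl : Irreflexive _≡_ Party
  Party-irrefl refl (pair-pair i≢i) = i≢i refl

  pair-injective : ∀ {i j : Fin H} {b c : Bool} → pair i b ≡ pair j c → i ≡ j × b ≡ c
  pair-injective refl = refl , refl

  k′ : ℕ
  k′ = h * 2 + 1

  Slot : Set
  Slot = (Fin h × Bool) ⊎ ⊤

  slots : Fin k′ ↔ Slot
  slots = ↔-trans Finₚ.+↔⊎ (×Bool↔ ⊎-↔ Finₚ.1↔⊤)

  slot : ∀ {v u} → Party v u → Slot
  slot (pair-pair {i} {c = c} i≢j)      = inj₁ (punchOut i≢j , c)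
  slot (pair-apex _)                    = inj₂ tt
  slot (apex-pair {suc i} {b} _)        = inj₁ (i , b)
  slot (apex-pair {zero}  {true} _)     = inj₂ tt
  slot (apex-pair {zero}  {false} ne)   = ⊥-elim (ne refl)

  slot-injective : ∀ {v u u′} (r : Party v u) (r′ : Party v u′) → slot r ≡ slot r′ → u ≡ u′
  slot-injective (pair-pair i≢j) (pair-pair i≢j′) eq =
    cong₂ pair (Finₚ.punchOut-injective i≢j i≢j′ (cong proj₁ (Sumₚ.inj₁-injective eq)))
               (cong proj₂ (Sumₚ.inj₁-injective eq))
  slot-injective (pair-apex _) (pair-apex _) _ = refl
  slot-injective (apex-pair {zero} {false} ne) _ _ = ⊥-elim (ne refl)
  slot-injective _ (apex-pair {zero} {false} ne) _ = ⊥-elim (ne refl)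
  slot-injective (apex-pair {suc i} _) (apex-pair {suc i′} _) refl = refl
  slot-injective (apex-pair {zero} {true} _) (apex-pair {zero} {true} _) _ = refl

  maxDegree : MaxDegree≤ Party k′
  maxDegree = Inverse.from slots ∘ slot ,
              λ r r′ → slot-injective r r′ ∘ ↔-injective (↔-sym slots)

  label : Vertex → Fin (suc (H * 2))
  label apex       = zero
  label (pair i b) = suc (Inverse.from ×Bool↔ (i , b))

  label-injective : ∀ {u v} → label u ≡ label v → u ≡ v
  label-injective {apex}     {apex}     _  = refl
  label-injective {pair _ _} {pair _ _} eq = cong just (↔-injective (↔-sym ×Bool↔) (Finₚ.suc-injective eq))

  matchingNumber : MatchingNumber< Party (suc H)
  matchingNumber = MatchingNumber<-vertices {R = Party} H (mk↣ label-injective)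

  apex-neighbour : Slot → Vertex
  apex-neighbour (inj₁ (i , b)) = pair (suc i) b
  apex-neighbour (inj₂ tt)      = pair zero true

  Edge : Set
  Edge = ((Fin H × Fin h) × Bool) ⊎ Slot

  -- Edge (i , j) b joins (i , b) to (punchIn i j , b′), with b′ flipped when punchIn i j < i,
  -- so that the four edges between two pairs arise from the two orders of the pair.
  src tgt : Edge → Vertex
  src (inj₁ ((i , j) , b)) = pair i b
  src (inj₂ _)             = apex
  tgt (inj₁ ((i , j) , b)) = pair (punchIn i j) (does (punchIn i j Fin.<? i) xor b)
  tgt (inj₂ s)             = apex-neighbour s

  adjacent : ∀ e → Party (src e) (tgt e)
  adjacent (inj₁ ((i , j) , b))  = pair-pair (Finₚ.punchInᵢ≢i i j ∘ sym)
  adjacent (inj₂ (inj₁ (i , b))) = apex-pair λ ()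
  adjacent (inj₂ (inj₂ tt))      = apex-pair λ ()

  distinct : ∀ e e′ → SameEdge (src e) (tgt e) (src e′) (tgt e′) → e ≡ e′
  distinct (inj₁ ((i , j) , b)) (inj₁ ((i′ , j′) , b′)) (inj₁ (refl , eq₂)) =
    cong (λ j → inj₁ ((i , j) , b)) (Finₚ.punchIn-injective i j j′ (proj₁ (pair-injective eq₂)))
  distinct (inj₁ ((i , j) , b)) (inj₁ ((_ , j′) , _)) (inj₂ (eq₁ , refl)) = contradiction (begin
      b                                                   ≡⟨ proj₂ (pair-injective eq₁) ⟩
      does (punchIn c j′ Fin.<? c) xor (flip-c xor b)
        ≡⟨ cong (λ x → does (x Fin.<? c) xor (flip-c xor b)) i≡ ⟩
      does (i Fin.<? c) xor (flip-c xor b)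
        ≡⟨ cong (_xor (flip-c xor b)) (<?-flip {i = i} {c} (c≢i ∘ sym)) ⟩
      not flip-c xor (flip-c xor b)                       ≡⟨ not-xor-xor flip-c b ⟩
      not b                                               ∎) (not-¬ refl)
    where
    open ≡-Reasoning
    c : Fin H
    c = punchIn i j
    flip-c : Bool
    flip-c = does (c Fin.<? i)
    i≡ : punchIn c j′ ≡ i
    i≡ = sym (proj₁ (pair-injective eq₁))
    c≢i : c ≢ i
    c≢i = Finₚ.punchInᵢ≢i i j
  distinct (inj₂ (inj₁ _)) (inj₂ (inj₁ _)) (inj₁ (_ , refl)) = refl
  distinct (inj₂ (inj₂ tt)) (inj₂ (inj₂ tt)) _ = refl
  distinct (inj₂ (inj₁ _)) (inj₂ (inj₂ _)) (inj₁ (_ , ()))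
  distinct (inj₂ (inj₂ _)) (inj₂ (inj₁ _)) (inj₁ (_ , ()))
  distinct (inj₂ _) (inj₂ (inj₁ _)) (inj₂ (() , _))
  distinct (inj₂ _) (inj₂ (inj₂ _)) (inj₂ (() , _))
  distinct (inj₁ _) (inj₂ _) (inj₁ (() , _))
  distinct (inj₁ _) (inj₂ _) (inj₂ (_ , ()))
  distinct (inj₂ _) (inj₁ _) (inj₁ (() , _))
  distinct (inj₂ _) (inj₁ _) (inj₂ (() , _))

  edges : EdgeList Party ((H * h) * 2 + k′)
  edges = record
    { Edge     = Edge
    ; index    = ↔-trans Finₚ.+↔⊎ (↔-trans ×Bool↔ (Finₚ.*↔× ×-↔ ↔-refl) ⊎-↔ slots)
    ; src      = src
    ; tgt      = tgt
    ; adjacent = adjacent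
    ; distinct = distinct
    }

private
  even-vertex-count : ∀ h → 3 * (suc h + suc h) ≡ (suc (suc h * 2) + (h + (h * 2 + 1))) + suc (suc h)
  even-vertex-count = solve-∀

  even-matching-count : ∀ h → suc h + h ≡ h * 2 + 1
  even-matching-count = solve-∀

  even-degree-count : ∀ h → suc (h * 2 + 1) ≡ suc h + suc h
  even-degree-count = solve-∀

  even-edge-count : ∀ h → (suc h + suc h) * (suc h + suc h) + 2 ≡
    suc (suc (((suc h * h) * 2 + (h * 2 + 1)) + h * (h * 2 + 1))) + 3 * suc h
  even-edge-count = solve-∀

ArAtLeast-even : ∀ {n} h → let k = suc h + suc h in 3 * k ≤ n → ArAtLeast n k (k * k + 2 ∸ 3 * (k / 2))
ArAtLeast-even {n} h 3k≤n = subst₂ (ArAtLeast n) (even-degree-count h) (sym edges≡)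
  (ArAtLeast-graph {R = Party ⊕ Bipartite {h} {k′}} embedding
    (⊕-sym Party-sym Bipartite-sym) (⊕-irrefl Party-irrefl Bipartite-irrefl)
    (⊕-edgeList edges Bipartite-edges) {inj₁ apex} {inj₁ (pair zero false)} (λ ())
    (λ { (left (apex-pair ne)) → ne refl })
    (⊕-maxDegree maxDegree (Bipartite-maxDegree (≤-trans (m≤m*n h 2) (m≤m+n (h * 2) 1))))
    (MatchingNumber<-≤ {R = Party ⊕ Bipartite} (≤-reflexive (cong suc (even-matching-count h)))
      (⊕-matchingNumber matchingNumber Bipartite-matchingNumber)))
  where
  open CocktailParty h
  k : ℕ
  k = H + H
  embedding : (Vertex ⊎ (Fin h ⊎ Fin k′)) ↣ Fin n
  embedding = ↣-trans (mk↣ label-injective ⊎-↣ ↔⇒↣ (↔-sym Finₚ.+↔⊎))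
             (↣-trans (↔⇒↣ (↔-sym Finₚ.+↔⊎))
               (inject≤-↣ (≤-trans (m≤m+n _ _) (≤-trans (≤-reflexive (sym (even-vertex-count h))) 3k≤n))))
  M : ℕ
  M = ((H * h) * 2 + k′) + h * k′
  k/2≡H : k / 2 ≡ H
  k/2≡H = trans (cong (_/ 2) (sym (m*2≡m+m H))) (m*n/n≡m H 2)
  edges≡ : k * k + 2 ∸ 3 * (k / 2) ≡ suc (suc M)
  edges≡ = begin
    k * k + 2 ∸ 3 * (k / 2)     ≡⟨ cong (λ x → k * k + 2 ∸ 3 * x) k/2≡H ⟩
    k * k + 2 ∸ 3 * H           ≡⟨ cong (_∸ 3 * H) (even-edge-count h) ⟩
    suc (suc M) + 3 * H ∸ 3 * H ≡⟨ m+n∸n≡m (suc (suc M)) (3 * H) ⟩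
    suc (suc M)                 ∎
    where open ≡-Reasoning

-- k = 2

module StarColouring (n : ℕ) where
  N : ℕ
  N = suc (suc (suc n))

  at-zero : Fin N → Fin 3
  at-zero (suc zero) = suc zero
  at-zero _          = suc (suc zero)

  colour : Fin N → Fin N → Fin 3
  colour zero    v       = at-zero v
  colour (suc u) zero    = at-zero (suc u)
  colour (suc u) (suc v) = zero

  colour-sym : ∀ u v → colour u v ≡ colour v u
  colour-sym zero    zero    = refl
  colour-sym zero    (suc v) = refl
  colour-sym (suc u) zero    = refl
  colour-sym (suc u) (suc v) = refl

  colouring : Colouring N 3
  colouring = record { col = colour ; sym = colour-sym }

  colour-surjective : UsesExactly colouring
  colour-surjective zero             = suc zero , suc (suc zero) , (λ ()) , refl
  colour-surjective (suc zero)       = zero , suc zero , (λ ()) , refl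
  colour-surjective (suc (suc zero)) = zero , suc (suc zero) , (λ ()) , refl

  colour-degree : ∀ v → ColourDegree≤ colouring v 2
  colour-degree zero = class , class-ok
    where
    class : Fin N → Fin 2
    class (suc zero) = zero
    class _          = suc zero
    class-ok : ∀ u u′ → u ≢ zero → u′ ≢ zero → class u ≡ class u′ → at-zero u ≡ at-zero u′
    class-ok zero _ u≢0 _ _ = contradiction refl u≢0
    class-ok _ zero _ u′≢0 _ = contradiction refl u′≢0
    class-ok (suc zero)    (suc zero)    _ _ _ = refl
    class-ok (suc (suc _)) (suc (suc _)) _ _ _ = refl
  colour-degree (suc v) = class , class-ok
    where
    class : Fin N → Fin 2
    class zero    = suc zero
    class (suc _) = zero
    class-ok : ∀ u u′ → u ≢ suc v → u′ ≢ suc v → class u ≡ class u′ →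
      colour (suc v) u ≡ colour (suc v) u′
    class-ok zero    zero    _ _ _ = refl
    class-ok (suc _) (suc _) _ _ _ = refl

  matchingNumber : MatchingNumber< (λ u v → colour u v ≢ zero) 2
  matchingNumber = MatchingNumber<-cover (λ _ → zero) covers
    where
    covers : ∀ {u v} → colour u v ≢ zero → Σ (Fin 1) λ _ → zero ≡ u ⊎ zero ≡ v
    covers {zero}  {_}     _  = zero , inj₁ refl
    covers {suc _} {zero}  _  = zero , inj₂ refl
    covers {suc _} {suc _} ≢0 = contradiction refl ≢0

ArAtLeast-two : ∀ {n} → 3 ≤ n → ArAtLeast n 2 4
ArAtLeast-two {suc (suc (suc n))} _ = rainbow-free⇒ArAtLeast colouring colour-surjective
  (no-rainbow-star colouring 2 colour-degree , no-rainbow-matching colouring zero 2 matchingNumber)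
  where open StarColouring n
ArAtLeast-two {suc zero}       (s≤s ())
ArAtLeast-two {suc (suc zero)} (s≤s (s≤s ()))

odd⇒≡suc[*2] : ∀ {k} → ¬ 2 ∣ k → ∃[ h ] k ≡ suc (h * 2)
odd⇒≡suc[*2] {k} 2∤k with k % 2 | m≡m%n+[m/n]*n k 2 | m%n<n k 2
... | zero        | k≡ | _ = contradiction (divides (k / 2) k≡) 2∤k
... | suc zero    | k≡ | _ = k / 2 , k≡
... | suc (suc _) | _  | s≤s (s≤s ())

even⇒≡double : ∀ {k} → 2 ∣ k → 2 ≤ k → ∃[ h ] k ≡ suc h + suc h
even⇒≡double (divides zero    refl) ()
even⇒≡double (divides (suc h) refl) _ = h , m*2≡m+m (suc h)

lemma3p4 : (k n : ℕ) → 2 ≤ k → 3 * k ≤ n →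
    (k ≡ 2 → ArAtLeast n k 4) ×
    (¬ (2 ∣ k) → ArAtLeast n k (k * k ∸ k + 2)) ×
    (2 ∣ k → 4 ≤ k → ArAtLeast n k (k * k + 2 ∸ 3 * (k / 2)))
lemma3p4 k n 2≤k 3k≤n = case-two , case-odd , case-even
  where
  k+k≤n : k + k ≤ n
  k+k≤n = ≤-trans (+-monoʳ-≤ k (m≤m+n k (k + 0))) 3k≤n
  case-two : k ≡ 2 → ArAtLeast n k 4
  case-two refl = ArAtLeast-two (≤-trans (m≤m+n 3 3) 3k≤n)
  case-odd : ¬ (2 ∣ k) → ArAtLeast n k (k * k ∸ k + 2)
  case-odd 2∤k with h , refl ← odd⇒≡suc[*2] 2∤k = ArAtLeast-odd h k+k≤n
  case-even : 2 ∣ k → 4 ≤ k → ArAtLeast n k (k * k + 2 ∸ 3 * (k / 2))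
  -- the construction works for every even k ≥ 2
  case-even 2∣k _ with h , refl ← even⇒≡double 2∣k 2≤k = ArAtLeast-even h 3k≤n
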